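{- Let $\mathcal{G}$ be a connected, locally Schur positive signed, colored graph of degree $4$ (i.e. of type $(4,4)$). Then the quasisymmetric generating function $\sum_{v\in V}Q_{\sigma(v)}(X)$ of $\mathcal{G}$ is either $s_{\lambda}$ for some partition $\lambda$ of $4$, or has one of the forms $s_{(3,1)}+k\,s_{(2,2)}$, $k\,s_{(2,2)}$, $s_{(2,1,1)}+k\,s_{(2,2)}$ for some positive integer $k$.
   Context: For $\sigma=(\sigma_1,\dots,\sigma_{m-1})\in\{\pm1\}^{m-1}$, the fundamental quasisymmetric function is $Q_\sigma(X)=\sum x_{i_1}\cdots x_{i_m}$, the sum over $i_1\le\cdots\le i_m$ with $i_j<i_{j+1}$ whenever $\sigma_j=-1$. $s_\lambda$ denotes the Schur function. A symmetric function is Schur positive if its Schur expansion has nonnegative coefficients. A signed, colored graph of type $(n,N)$ is $\mathcal{G}=(V,\sigma,E_2\cup\cdots\cup E_{n-1})$ with $V$ finite, $\sigma:V\to\{\pm1\}^{N-1}$ (write $\sigma(v)_j$ for the $j$-th entry), and for each $1<i<n$ a set $E_i$ of $2$-element subsets of $V$ ($i$-edges). Its generating function is $\sum_{v\in V}Q_{\sigma(v)}(X)$; "degree $n$" means type $(n,n)$. If $w$ lies in a unique $i$-edge $\{w,x\}$ we write $x=E_i(w)$ and say $w$ has an $i$-neighbour. Axioms: (ax1) for $w\in V$ and $1<i<n$, $\sigma(w)_{i-1}=-\sigma(w)_i$ iff there is $x$ with $\{w,x\}\in E_i$, and such $x$ is unique. (ax2) if $\{w,x\}\in E_i$ then $\sigma(w)_j=-\sigma(x)_j$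 for $j=i-1,i$, and $\sigma(w)_h=\sigma(x)_h$ for $h<i-2$ and $h>i+1$. (ax3) if $\{w,x\}\in E_i$ and $\sigma(w)_{i-2}=-\sigma(x)_{i-2}$ then $\sigma(w)_{i-2}=-\sigma(w)_{i-1}$; and if $\sigma(w)_{i+1}=-\sigma(x)_{i+1}$ then $\sigma(w)_{i+1}=-\sigma(w)_i$. (ax5) if $\{w,x\}\in E_i$, $\{x,y\}\in E_j$ with $|i-j|\ge3$, then there is $v$ with $\{w,v\}\in E_j$ and $\{v,y\}\in E_i$. For $m\ge4$, $m-2<i<n$ and a connected component $\mathcal{C}$ of $(V,E_{i-(m-3)}\cup\cdots\cup E_i)$, its restricted degree-$m$ generating function is $\sum_{v\in\mathcal{C}}Q_{(\sigma(v)_{i-(m-2)},\dots,\sigma(v)_i)}(X)$. $\mathcal{G}$ has $\mathrm{LSP}_m$ if all these are symmetric and Schur positive, and $\mathrm{LSF}_m$ if each equals a single Schur function $s_\lambda$. $\mathcal{G}$ is locally Schur positive if it satisfies (ax1), (ax2), (ax3), (ax5) and has $\mathrm{LSP}_4,\mathrm{LSP}_5,\mathrm{LSP}_6$. -}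

module Defs where

open import Data.Nat using (ℕ; zero; suc; _+_; _*_; _∸_; _≤_; _<_; _≡ᵇ_; _≤ᵇ_; _<ᵇ_; ∣_-_∣)
open import Data.Bool using (Bool; true; false; _∧_; if_then_else_)
open import Data.List using (List; []; _∷_; map; concatMap; length; take; drop; zipWith; allFin; upTo)
open import Data.Nat.ListAction using (sum)
open import Data.Bool.ListAction using (and)
open import Data.Unit using (⊤)
open import Data.List.Relation.Unary.All using (All)
open import Data.List.Relation.Unary.Linked using (Linked)
open import Data.Maybe using (Maybe; just; nothing)
open import Data.Vec using (Vec; toList)
open import Data.Fin using (Fin)
open import Data.Product using (Σ; ∃; _×_; proj₁; proj₂)
open import Data.Sum using (_⊎_)
open import Data.Empty using (⊥)
open import Relation.Binary.PropositionalEquality using (_≡_)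
open import Relation.Binary.Construct.Closure.ReflexiveTransitive using (Star)
open import Function.Bundles using (_⇔_)

data Sign : Set where
  plus minus : Sign

neg : Sign → Sign
neg plus  = minus
neg minus = plus

countB : {A : Set} → (A → Bool) → List A → ℕ
countB p []       = 0
countB p (x ∷ xs) = if p x then suc (countB p xs) else countB p xs

eqList : List ℕ → List ℕ → Bool
eqList []       []       = true
eqList (x ∷ xs) (y ∷ ys) = (x ≡ᵇ y) ∧ eqList xs ys
eqList _        _        = false

range1 : ℕ → List ℕ
range1 ℓ = map suc (upTo ℓ)

words : ℕ → ℕ → List (List ℕ)
words ℓ zero    = [] ∷ []
words ℓ (suc m) = concatMap (λ x → map (x ∷_) (words ℓ m)) (range1 ℓ)

content : ℕ → List ℕ → List ℕ
content ℓ w = map (λ k → countB (λ x → k ≡ᵇ x) w) (range1 ℓ)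

-- Formal power series in x_1, x_2, ... with ℕ coefficients are modelled
-- by their coefficient function: a monomial x_1^{a_1} ... x_ℓ^{a_ℓ} is
-- given by its exponent list a = (a_1,...,a_ℓ) (every monomial has this form).

Series : Set
Series = List ℕ → ℕ

_≐_ : Series → Series → Set
f ≐ g = (a : List ℕ) → f a ≡ g a

-- Fundamental quasisymmetric function Q_σ, σ ∈ {±1}^{m-1}:
-- sum of x_{i_1}...x_{i_m} over i_1 ≤ ... ≤ i_m with i_j < i_{j+1} when σ_j = -1.
admissible : List Sign → List ℕ → Bool
admissible (plus  ∷ ss) (x ∷ y ∷ ws) = (x ≤ᵇ y) ∧ admissible ss (y ∷ ws)
admissible (minus ∷ ss) (x ∷ y ∷ ws) = (x <ᵇ y) ∧ admissible ss (y ∷ ws)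
admissible _ _ = true

Q : List Sign → Series
Q σ a = countB (λ w → admissible σ w ∧ eqList (content (length a) w) a)
               (words (length a) (suc (length σ)))

IsPartition : ℕ → List ℕ → Set
IsPartition m λs = (sum λs ≡ m) × All (λ x → 1 ≤ x) λs × Linked (λ x y → y ≤ x) λs

-- Schur function s_λ = Σ_{T SSYT of shape λ} x^T.
-- A filling of shape λ is a list of rows (row r has length λ_r).
fillings : ℕ → List ℕ → List (List (List ℕ))
fillings ℓ []         = [] ∷ []
fillings ℓ (r ∷ rows) = concatMap (λ w → map (w ∷_) (fillings ℓ rows)) (words ℓ r)

weakInc : List ℕ → Bool
weakInc (x ∷ y ∷ ws) = (x ≤ᵇ y) ∧ weakInc (y ∷ ws)
weakInc _ = true

-- columns strictly increase downward (English notation)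
colStrict : List (List ℕ) → Bool
colStrict (r₁ ∷ r₂ ∷ rs) = and (zipWith _<ᵇ_ r₁ r₂) ∧ colStrict (r₂ ∷ rs)
colStrict _ = true

isSSYT : List (List ℕ) → Bool
isSSYT T = and (map weakInc T) ∧ colStrict T

s : List ℕ → Series
s λs a = countB (λ T → isSSYT T ∧ eqList (content (length a) (concatMap (λ r → r) T)) a)
                (fillings (length a) λs)

_·_ : ℕ → Series → Series
(k · f) a = k * f a

_⊕_ : Series → Series → Series
(f ⊕ g) a = f a + g a

SchurPositive : ℕ → Series → Set
SchurPositive m f =
  Σ (List (ℕ × List ℕ)) λ terms →
    All (λ t → IsPartition m (proj₂ t)) terms ×
    (f ≐ (λ a → sum (map (λ t → proj₁ t * s (proj₂ t) a) terms)))

-- V = Fin size; σ(v) ∈ {±1}^{N-1}; the i-edges E_i are given by a symmetric,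
-- irreflexive Bool-valued relation E i (i.e. a set of 2-element subsets),
-- nonempty only for 1 < i < n.

record SCGraph (n N : ℕ) : Set where
  field
    size     : ℕ
    σ        : Fin size → Vec Sign (N ∸ 1)
    E        : ℕ → Fin size → Fin size → Bool
    E-sym    : ∀ i v w → E i v w ≡ E i w v
    E-irrefl : ∀ i v → E i v v ≡ false
    E-range  : ∀ i v w → E i v w ≡ true → (1 < i) × (i < n)

-- 1-based entry lookup (nothing if out of range)
entry : {k : ℕ} → Vec Sign k → ℕ → Maybe Sign
entry v j = go (toList v) j
  where
  go : List Sign → ℕ → Maybe Sign
  go []       _             = nothing
  go (x ∷ xs) zero          = nothing
  go (x ∷ xs) (suc zero)    = just x
  go (x ∷ xs) (suc (suc j)) = go xs (suc j)

Opp : Maybe Sign → Maybe Sign → Set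
Opp (just x) (just y) = x ≡ neg y
Opp _        _        = ⊥

module _ {n N : ℕ} (G : SCGraph n N) where
  open SCGraph G

  V : Set
  V = Fin size

  sg : V → ℕ → Maybe Sign
  sg v j = entry (σ v) j

  Edge : ℕ → V → V → Set
  Edge i v w = E i v w ≡ true

  Ax1 : Set
  Ax1 = ∀ (w : V) (i : ℕ) → 1 < i → i < n →
          (Opp (sg w (i ∸ 1)) (sg w i) ⇔ ∃ λ x → Edge i w x) ×
          (∀ x y → Edge i w x → Edge i w y → x ≡ y)

  Ax2 : Set
  Ax2 = ∀ (i : ℕ) (w x : V) → Edge i w x →
          Opp (sg w (i ∸ 1)) (sg x (i ∸ 1)) × Opp (sg w i) (sg x i) ×
          (∀ h → (h < i ∸ 2) ⊎ (i + 1 < h) → sg w h ≡ sg x h)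

  Ax3 : Set
  Ax3 = ∀ (i : ℕ) (w x : V) → Edge i w x →
          (Opp (sg w (i ∸ 2)) (sg x (i ∸ 2)) → Opp (sg w (i ∸ 2)) (sg w (i ∸ 1))) ×
          (Opp (sg w (i + 1)) (sg x (i + 1)) → Opp (sg w (i + 1)) (sg w i))

  Ax5 : Set
  Ax5 = ∀ (i j : ℕ) (w x y : V) → Edge i w x → Edge j x y → 3 ≤ ∣ i - j ∣ →
          ∃ λ v → Edge j w v × Edge i v y

  EdgeIn : ℕ → ℕ → V → V → Set
  EdgeIn a b v w = ∃ λ j → (a ≤ j) × (j ≤ b) × Edge j v w

  IsComponent : ℕ → ℕ → (V → Bool) → Set
  IsComponent a b C =
    (∃ λ v → C v ≡ true) ×
    (∀ v w → C v ≡ true → C w ≡ true → Star (EdgeIn a b) v w) ×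
    (∀ v w → C v ≡ true → EdgeIn a b v w → C w ≡ true)

  sumV : (V → ℕ) → ℕ
  sumV f = sum (map f (allFin size))

  -- entries s..e (1-based, inclusive) of σ(v)
  slice : ℕ → ℕ → V → List Sign
  slice st e v = take (suc (e ∸ st)) (drop (st ∸ 1) (toList (σ v)))

  restrictedGF : ℕ → ℕ → (V → Bool) → Series
  restrictedGF m i C a = sumV (λ v → if C v then Q (slice (i ∸ (m ∸ 2)) i v) a else 0)

  LSP : ℕ → Set
  LSP m = ∀ i → m ∸ 2 < i → i < n → ∀ C → IsComponent (i ∸ (m ∸ 3)) i C →
            SchurPositive m (restrictedGF m i C)

  LocallySchurPositive : Set
  LocallySchurPositive = Ax1 × Ax2 × Ax3 × Ax5 × LSP 4 × LSP 5 × LSP 6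

  Connected : Set
  Connected = (∃ λ (v : V) → ⊤) × (∀ v w → Star (λ x y → ∃ λ i → Edge i x y) v w)

  genFun : Series
  genFun a = sumV (λ v → Q (toList (σ v)) a)

module Submission where

-- A vertex v carries a sign vector σ(v) ∈ {±1}³, identified with its descent set
-- D(v) ⊆ {1,2,3} (the positions of -1).
--
-- Q_D evaluated at the monomial x^α(S), where α(S) is the composition of 4
-- with partial-sum set S, is 1 if D ⊆ S and 0 otherwise; so the generating function at
-- x^α(S) counts the vertices with D(v) ⊆ S.  LSP₄ writes the generating function as
-- a s₄ + b s₃₁ + c s₂₂ + d s₂₁₁ + e s₁₁₁₁; evaluating the Schur functions at the same
-- eight monomials (Kostka numbers) and inverting over the subset lattice gives the
-- number κ(D) of vertices of each descent set: a, b, b+c, b, d, c+d, d, e.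
--
-- By axiom 1 the 2-edges and 3-edges, completed by fixed points,
-- are two involutions whose orbit is the whole (connected) graph.  Such a path or
-- cycle has at most two vertices fixed by one of the involutions, and a vertex fixed
-- by both is the only vertex.  Vertices with D ∉ {{2},{1,3}} lack an edge, and
-- D = ∅ or D = {1,2,3} lack both.
--
-- Arithmetic.  Hence a + 2b + 2d + e ≤ 2, a or e nonzero forces a single vertex, and
-- there is at least one vertex; a short case analysis leaves exactly the listed forms.

open import Defs
open import Data.Nat using (ℕ; zero; suc; _+_; _*_; _∸_; _≤_; _<_; z≤n; s≤s; _≤?_)
open import Data.Nat.Properties
  using (≤-refl; ≤-reflexive; ≤-trans; +-mono-≤; m≤m+n; m≤n+m; m+n≤o⇒n≤o; +-cancelʳ-≡; n≤1+n;
         m≤n⇒m<n∨m≡n; m<1+n⇒m<n∨m≡n; +-0-commutativeMonoid; module ≤-Reasoning)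
open import Data.Nat.ListAction using (sum)
open import Data.Nat.Tactic.RingSolver using (solve-∀)
open import Data.Bool using (true; if_then_else_)
import Data.Bool.Properties as Bool
open import Data.Fin using (Fin; zero; suc)
import Data.Fin.Properties as Fin
open import Data.List using (List; []; _∷_; map; tabulate; allFin; take)
open import Data.List.Properties using (map-cong; map-cong-local)
open import Data.List.Relation.Unary.All using (All; []; _∷_)
open import Data.List.Relation.Unary.Linked using ([-]; _∷_)
open import Data.Vec using (Vec; []; _∷_; toList)
open import Data.Vec.Properties using (≡-dec)
open import Data.Product using (Σ; ∃; _×_; _,_; proj₁; proj₂)
open import Data.Sum using (_⊎_; inj₁; inj₂; [_,_]′; swap)
open import Data.Empty using (⊥-elim)
open import Function using (_∘_)
open import Function.Bundles using (Equivalence)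
open import Relation.Nullary using (¬_; Dec; yes; no; does)
open import Relation.Nullary.Decidable using (_⊎-dec_; _×-dec_; ¬?; decidable-stable)
open import Relation.Unary using (Decidable)
open import Relation.Binary.Definitions using (DecidableEquality)
open import Relation.Binary.PropositionalEquality
  using (_≡_; refl; sym; trans; cong; cong₂; subst; _≗_; module ≡-Reasoning)
open import Relation.Binary.Construct.Closure.ReflexiveTransitive using (Star; ε; _◅_)
import Relation.Binary.Construct.Closure.ReflexiveTransitive as Star
open import Algebra.Properties.CommutativeMonoid.Sum +-0-commutativeMonoid
  using (∑-distrib-+; sum-cong-≗; sum-replicate-zero) renaming (sum to ∑)

-- Partitions of 4 and Schur positive functions of degree 4

data PartitionOf4 : List ℕ → Set where
  [4]    : PartitionOf4 (4 ∷ [])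
  [31]   : PartitionOf4 (3 ∷ 1 ∷ [])
  [22]   : PartitionOf4 (2 ∷ 2 ∷ [])
  [211]  : PartitionOf4 (2 ∷ 1 ∷ 1 ∷ [])
  [1111] : PartitionOf4 (1 ∷ 1 ∷ 1 ∷ 1 ∷ [])

partitionOf4 : ∀ λs → IsPartition 4 λs → PartitionOf4 λs
partitionOf4 [] (() , _)
partitionOf4 (0 ∷ _) (_ , () ∷ _ , _)
partitionOf4 (1 ∷ []) (() , _)
partitionOf4 (1 ∷ 0 ∷ _) (_ , _ ∷ () ∷ _ , _)
partitionOf4 (1 ∷ 1 ∷ []) (() , _)
partitionOf4 (1 ∷ 1 ∷ 0 ∷ _) (_ , _ ∷ _ ∷ () ∷ _ , _)
partitionOf4 (1 ∷ 1 ∷ 1 ∷ []) (() , _)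
partitionOf4 (1 ∷ 1 ∷ 1 ∷ 0 ∷ _) (_ , _ ∷ _ ∷ _ ∷ () ∷ _ , _)
partitionOf4 (1 ∷ 1 ∷ 1 ∷ 1 ∷ []) _ = [1111]
partitionOf4 (1 ∷ 1 ∷ 1 ∷ 1 ∷ 0 ∷ _) (_ , _ ∷ _ ∷ _ ∷ _ ∷ () ∷ _ , _)
partitionOf4 (1 ∷ 1 ∷ 1 ∷ 1 ∷ suc _ ∷ _) (() , _)
partitionOf4 (1 ∷ 1 ∷ 1 ∷ suc (suc _) ∷ _) (_ , _ , _ ∷ _ ∷ s≤s () ∷ _)
partitionOf4 (1 ∷ 1 ∷ suc (suc _) ∷ _) (_ , _ , _ ∷ s≤s () ∷ _)
partitionOf4 (1 ∷ suc (suc _) ∷ _) (_ , _ , s≤s () ∷ _)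
partitionOf4 (2 ∷ []) (() , _)
partitionOf4 (2 ∷ 0 ∷ _) (_ , _ ∷ () ∷ _ , _)
partitionOf4 (2 ∷ 1 ∷ []) (() , _)
partitionOf4 (2 ∷ 1 ∷ 0 ∷ _) (_ , _ ∷ _ ∷ () ∷ _ , _)
partitionOf4 (2 ∷ 1 ∷ 1 ∷ []) _ = [211]
partitionOf4 (2 ∷ 1 ∷ 1 ∷ 0 ∷ _) (_ , _ ∷ _ ∷ _ ∷ () ∷ _ , _)
partitionOf4 (2 ∷ 1 ∷ 1 ∷ suc _ ∷ _) (() , _)
partitionOf4 (2 ∷ 1 ∷ suc (suc _) ∷ _) (_ , _ , _ ∷ s≤s () ∷ _)
partitionOf4 (2 ∷ 2 ∷ []) _ = [22]
partitionOf4 (2 ∷ 2 ∷ 0 ∷ _) (_ , _ ∷ _ ∷ () ∷ _ , _)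
partitionOf4 (2 ∷ 2 ∷ suc _ ∷ _) (() , _)
partitionOf4 (2 ∷ suc (suc (suc _)) ∷ _) (_ , _ , s≤s (s≤s ()) ∷ _)
partitionOf4 (3 ∷ []) (() , _)
partitionOf4 (3 ∷ 0 ∷ _) (_ , _ ∷ () ∷ _ , _)
partitionOf4 (3 ∷ 1 ∷ []) _ = [31]
partitionOf4 (3 ∷ 1 ∷ 0 ∷ _) (_ , _ ∷ _ ∷ () ∷ _ , _)
partitionOf4 (3 ∷ 1 ∷ suc _ ∷ _) (() , _)
partitionOf4 (3 ∷ suc (suc _) ∷ _) (() , _)
partitionOf4 (4 ∷ []) _ = [4]
partitionOf4 (4 ∷ 0 ∷ _) (_ , _ ∷ () ∷ _ , _)
partitionOf4 (4 ∷ suc _ ∷ _) (() , _)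
partitionOf4 (suc (suc (suc (suc (suc _)))) ∷ _) (() , _)

s₄ s₃₁ s₂₂ s₂₁₁ s₁₁₁₁ : Series
s₄    = s (4 ∷ [])
s₃₁   = s (3 ∷ 1 ∷ [])
s₂₂   = s (2 ∷ 2 ∷ [])
s₂₁₁  = s (2 ∷ 1 ∷ 1 ∷ [])
s₁₁₁₁ = s (1 ∷ 1 ∷ 1 ∷ 1 ∷ [])

combination : ℕ → ℕ → ℕ → ℕ → ℕ → Series
combination a b c d e x = a * s₄ x + b * s₃₁ x + c * s₂₂ x + d * s₂₁₁ x + e * s₁₁₁₁ x

record Expansion (f : Series) : Set where
  constructor expansion
  field
    a b c d e : ℕ
    expand    : f ≐ combination a b c d e

collect : (terms : List (ℕ × List ℕ)) → All (λ t → IsPartition 4 (proj₂ t)) terms →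
          Expansion (λ x → sum (map (λ t → proj₁ t * s (proj₂ t) x) terms))
collect [] [] = expansion 0 0 0 0 0 (λ _ → refl)
collect ((k , λs) ∷ ts) (p ∷ ps) with partitionOf4 λs p | collect ts ps
... | [4]    | expansion a b c d e h =
  expansion (k + a) b c d e λ x → trans (cong (k * s₄ x +_) (h x)) (add₁ k a b c d e _ _ _ _ _)
  where
  add₁ : ∀ k a b c d e x₁ x₂ x₃ x₄ x₅ →
         k * x₁ + (a * x₁ + b * x₂ + c * x₃ + d * x₄ + e * x₅) ≡ (k + a) * x₁ + b * x₂ + c * x₃ + d * x₄ + e * x₅
  add₁ = solve-∀
... | [31]   | expansion a b c d e h =
  expansion a (k + b) c d e λ x → trans (cong (k * s₃₁ x +_) (h x)) (add₂ k a b c d e _ _ _ _ _)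
  where
  add₂ : ∀ k a b c d e x₁ x₂ x₃ x₄ x₅ →
         k * x₂ + (a * x₁ + b * x₂ + c * x₃ + d * x₄ + e * x₅) ≡ a * x₁ + (k + b) * x₂ + c * x₃ + d * x₄ + e * x₅
  add₂ = solve-∀
... | [22]   | expansion a b c d e h =
  expansion a b (k + c) d e λ x → trans (cong (k * s₂₂ x +_) (h x)) (add₃ k a b c d e _ _ _ _ _)
  where
  add₃ : ∀ k a b c d e x₁ x₂ x₃ x₄ x₅ →
         k * x₃ + (a * x₁ + b * x₂ + c * x₃ + d * x₄ + e * x₅) ≡ a * x₁ + b * x₂ + (k + c) * x₃ + d * x₄ + e * x₅
  add₃ = solve-∀
... | [211]  | expansion a b c d e h =
  expansion a b c (k + d) e λ x → trans (cong (k * s₂₁₁ x +_) (h x)) (add₄ k a b c d e _ _ _ _ _)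
  where
  add₄ : ∀ k a b c d e x₁ x₂ x₃ x₄ x₅ →
         k * x₄ + (a * x₁ + b * x₂ + c * x₃ + d * x₄ + e * x₅) ≡ a * x₁ + b * x₂ + c * x₃ + (k + d) * x₄ + e * x₅
  add₄ = solve-∀
... | [1111] | expansion a b c d e h =
  expansion a b c d (k + e) λ x → trans (cong (k * s₁₁₁₁ x +_) (h x)) (add₅ k a b c d e _ _ _ _ _)
  where
  add₅ : ∀ k a b c d e x₁ x₂ x₃ x₄ x₅ →
         k * x₅ + (a * x₁ + b * x₂ + c * x₃ + d * x₄ + e * x₅) ≡ a * x₁ + b * x₂ + c * x₃ + d * x₄ + (k + e) * x₅
  add₅ = solve-∀

schurExpansion : ∀ {f} → SchurPositive 4 f → Expansion f
schurExpansion (terms , partitions , f≐terms) =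
  expansion a b c d e (λ x → trans (f≐terms x) (expand x))
  where open Expansion (collect terms partitions)

-- Descent sets of degree-4 vertices and the eight test monomials

-- A sign vector in {±1}³, named below by its descent set (the positions of -1).
Type : Set
Type = Vec Sign 3

pattern D∅   = plus  ∷ plus  ∷ plus  ∷ []
pattern D1   = minus ∷ plus  ∷ plus  ∷ []
pattern D2   = plus  ∷ minus ∷ plus  ∷ []
pattern D3   = plus  ∷ plus  ∷ minus ∷ []
pattern D12  = minus ∷ minus ∷ plus  ∷ []
pattern D13  = minus ∷ plus  ∷ minus ∷ []
pattern D23  = plus  ∷ minus ∷ minus ∷ []
pattern D123 = minus ∷ minus ∷ minus ∷ []

every-type : (P : Type → Set) → P D∅ → P D1 → P D2 → P D3 → P D12 → P D13 → P D23 → P D123 →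
             ∀ t → P t
every-type P p∅ p1 p2 p3 p12 p13 p23 p123 D∅   = p∅
every-type P p∅ p1 p2 p3 p12 p13 p23 p123 D1   = p1
every-type P p∅ p1 p2 p3 p12 p13 p23 p123 D2   = p2
every-type P p∅ p1 p2 p3 p12 p13 p23 p123 D3   = p3
every-type P p∅ p1 p2 p3 p12 p13 p23 p123 D12  = p12
every-type P p∅ p1 p2 p3 p12 p13 p23 p123 D13  = p13
every-type P p∅ p1 p2 p3 p12 p13 p23 p123 D23  = p23
every-type P p∅ p1 p2 p3 p12 p13 p23 p123 D123 = p123

_≟ˢ_ : DecidableEquality Sign
plus  ≟ˢ plus  = yes refl
plus  ≟ˢ minus = no λ ()
minus ≟ˢ plus  = no λ ()
minus ≟ˢ minus = yes refl

_≟ᵗ_ : DecidableEquality Type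
_≟ᵗ_ = ≡-dec _≟ˢ_

ind : Type → Type → ℕ
ind u t = if does (u ≟ᵗ t) then 1 else 0

ind-positive : ∀ u t → 1 ≤ ind u t → u ≡ t
ind-positive u t _ with u ≟ᵗ t
ind-positive u t _  | yes u≡t = u≡t
ind-positive u t () | no  _

countIn : List Type → Type → ℕ
countIn us t = sum (map (λ u → ind u t) us)

-- α S: the composition of 4 whose set of proper partial sums is S.
α : Type → List ℕ
α D∅   = 4 ∷ []
α D1   = 1 ∷ 3 ∷ []
α D2   = 2 ∷ 2 ∷ []
α D3   = 3 ∷ 1 ∷ []
α D12  = 1 ∷ 1 ∷ 2 ∷ []
α D13  = 1 ∷ 2 ∷ 1 ∷ []
α D23  = 2 ∷ 1 ∷ 1 ∷ []
α D123 = 1 ∷ 1 ∷ 1 ∷ 1 ∷ []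

strictlyBelow : Type → List Type
strictlyBelow D∅   = []
strictlyBelow D1   = D∅ ∷ []
strictlyBelow D2   = D∅ ∷ []
strictlyBelow D3   = D∅ ∷ []
strictlyBelow D12  = D∅ ∷ D1 ∷ D2 ∷ []
strictlyBelow D13  = D∅ ∷ D1 ∷ D3 ∷ []
strictlyBelow D23  = D∅ ∷ D2 ∷ D3 ∷ []
strictlyBelow D123 = D∅ ∷ D1 ∷ D2 ∷ D3 ∷ D12 ∷ D13 ∷ D23 ∷ []

below : Type → List Type
below S = S ∷ strictlyBelow S

Q-at : ∀ S t → Q (toList t) (α S) ≡ countIn (below S) t
Q-at = every-type _
  (every-type _ refl refl refl refl refl refl refl refl)
  (every-type _ refl refl refl refl refl refl refl refl)
  (every-type _ refl refl refl refl refl refl refl refl)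
  (every-type _ refl refl refl refl refl refl refl refl)
  (every-type _ refl refl refl refl refl refl refl refl)
  (every-type _ refl refl refl refl refl refl refl refl)
  (every-type _ refl refl refl refl refl refl refl refl)
  (every-type _ refl refl refl refl refl refl refl refl)

-- Fundamental expansion: a s₄ + b s₃₁ + c s₂₂ + d s₂₁₁ + e s₁₁₁₁ = Σ_D κ(D) Q_D,
-- from s₄ = Q_∅, s₃₁ = Q_1 + Q_2 + Q_3, s₂₂ = Q_2 + Q_13, s₂₁₁ = Q_12 + Q_13 + Q_23,
-- s₁₁₁₁ = Q_123.
κ : ℕ → ℕ → ℕ → ℕ → ℕ → Type → ℕ
κ a b c d e D∅   = a
κ a b c d e D1   = b
κ a b c d e D2   = b + c
κ a b c d e D3   = b
κ a b c d e D12  = d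
κ a b c d e D13  = c + d
κ a b c d e D23  = d
κ a b c d e D123 = e

-- The Kostka numbers K_{λ,α(S)}: the combination evaluated at x^α(S) equals
-- Σ_{D ⊆ S} κ(D), as the fundamental expansion predicts.
combination-at : ∀ a b c d e S → combination a b c d e (α S) ≡ sum (map (κ a b c d e) (below S))
combination-at a b c d e D∅   = at∅ a b c d e
  where
  at∅ : ∀ a b c d e → a * 1 + b * 0 + c * 0 + d * 0 + e * 0 ≡ a + 0
  at∅ = solve-∀
combination-at a b c d e D1   = at1 a b c d e
  where
  at1 : ∀ a b c d e → a * 1 + b * 1 + c * 0 + d * 0 + e * 0 ≡ b + (a + 0)
  at1 = solve-∀
combination-at a b c d e D2   = at2 a b c d e
  where
  at2 : ∀ a b c d e → a * 1 + b * 1 + c * 1 + d * 0 + e * 0 ≡ b + c + (a + 0)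
  at2 = solve-∀
combination-at a b c d e D3   = at3 a b c d e
  where
  at3 : ∀ a b c d e → a * 1 + b * 1 + c * 0 + d * 0 + e * 0 ≡ b + (a + 0)
  at3 = solve-∀
combination-at a b c d e D12  = at12 a b c d e
  where
  at12 : ∀ a b c d e → a * 1 + b * 2 + c * 1 + d * 1 + e * 0 ≡ d + (a + (b + (b + c + 0)))
  at12 = solve-∀
combination-at a b c d e D13  = at13 a b c d e
  where
  at13 : ∀ a b c d e → a * 1 + b * 2 + c * 1 + d * 1 + e * 0 ≡ c + d + (a + (b + (b + 0)))
  at13 = solve-∀
combination-at a b c d e D23  = at23 a b c d e
  where
  at23 : ∀ a b c d e → a * 1 + b * 2 + c * 1 + d * 1 + e * 0 ≡ d + (a + (b + c + (b + 0)))
  at23 = solve-∀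
combination-at a b c d e D123 = at123 a b c d e
  where
  at123 : ∀ a b c d e → a * 1 + b * 3 + c * 2 + d * 3 + e * 1 ≡
                         e + (a + (b + (b + c + (b + (d + (c + d + (d + 0)))))))
  at123 = solve-∀

-- No sign change at position i (between entries i-1 and i): no i-edge by axiom 1.
Flat : ℕ → Type → Set
Flat i t = ¬ Opp (entry t (i ∸ 1)) (entry t i)

-- The descent sets of vertices lacking a 2-edge or a 3-edge: all but {2} and {1,3}.
endTypes : List Type
endTypes = D1 ∷ D3 ∷ D12 ∷ D23 ∷ D∅ ∷ D123 ∷ []

endType-≤1 : ∀ t → countIn endTypes t ≤ 1
endType-≤1 = every-type _ (s≤s z≤n) (s≤s z≤n) z≤n (s≤s z≤n) (s≤s z≤n) z≤n (s≤s z≤n) (s≤s z≤n)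

endType-flat : ∀ t → 1 ≤ countIn endTypes t → Flat 2 t ⊎ Flat 3 t
endType-flat D∅   _ = inj₁ λ ()
endType-flat D1   _ = inj₂ λ ()
endType-flat D2   ()
endType-flat D3   _ = inj₁ λ ()
endType-flat D12  _ = inj₁ λ ()
endType-flat D13  ()
endType-flat D23  _ = inj₂ λ ()
endType-flat D123 _ = inj₁ λ ()

allTypes : List Type
allTypes = D∅ ∷ D123 ∷ D2 ∷ D13 ∷ D1 ∷ D3 ∷ D12 ∷ D23 ∷ []

allTypes-once : ∀ t → countIn allTypes t ≡ 1
allTypes-once = every-type _ refl refl refl refl refl refl refl refl

Classification : Series → Set
Classification g =
  (Σ (List ℕ) λ lam → IsPartition 4 lam × (g ≐ s lam))
  ⊎ (Σ ℕ λ k → (1 ≤ k) × (g ≐ (s (3 ∷ 1 ∷ []) ⊕ (k · s (2 ∷ 2 ∷ [])))))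
  ⊎ (Σ ℕ λ k → (1 ≤ k) × (g ≐ (k · s (2 ∷ 2 ∷ []))))
  ⊎ (Σ ℕ λ k → (1 ≤ k) × (g ≐ (s (2 ∷ 1 ∷ 1 ∷ []) ⊕ (k · s (2 ∷ 2 ∷ [])))))

data Shape : ℕ → ℕ → ℕ → ℕ → ℕ → Set where
  only₄      : Shape 1 0 0 0 0
  only₁₁₁₁   : Shape 0 0 0 0 1
  s₃₁-plus   : ∀ k → Shape 0 1 k 0 0
  multiple₂₂ : ∀ k → 1 ≤ k → Shape 0 0 k 0 0
  s₂₁₁-plus  : ∀ k → Shape 0 0 k 1 0

classify : ∀ {a b c d e} (g : Series) → g ≐ combination a b c d e → Shape a b c d e → Classification g
classify g h only₄ =
  inj₁ (4 ∷ [] , (refl , s≤s z≤n ∷ [] , [-]) , λ x → trans (h x) (pick₁ (s₄ x) (s₃₁ x) (s₂₂ x) (s₂₁₁ x) (s₁₁₁₁ x)))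
  where
  pick₁ : ∀ x₁ x₂ x₃ x₄ x₅ → 1 * x₁ + 0 * x₂ + 0 * x₃ + 0 * x₄ + 0 * x₅ ≡ x₁
  pick₁ = solve-∀
classify g h only₁₁₁₁ =
  inj₁ (1 ∷ 1 ∷ 1 ∷ 1 ∷ [] , (refl , s≤s z≤n ∷ s≤s z≤n ∷ s≤s z≤n ∷ s≤s z≤n ∷ [] , s≤s z≤n ∷ s≤s z≤n ∷ s≤s z≤n ∷ [-]) ,
        λ x → trans (h x) (pick₅ (s₄ x) (s₃₁ x) (s₂₂ x) (s₂₁₁ x) (s₁₁₁₁ x)))
  where
  pick₅ : ∀ x₁ x₂ x₃ x₄ x₅ → 0 * x₁ + 0 * x₂ + 0 * x₃ + 0 * x₄ + 1 * x₅ ≡ x₅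
  pick₅ = solve-∀
classify g h (s₃₁-plus zero) =
  inj₁ (3 ∷ 1 ∷ [] , (refl , s≤s z≤n ∷ s≤s z≤n ∷ [] , s≤s z≤n ∷ [-]) , λ x → trans (h x) (pick₂ (s₄ x) (s₃₁ x) (s₂₂ x) (s₂₁₁ x) (s₁₁₁₁ x)))
  where
  pick₂ : ∀ x₁ x₂ x₃ x₄ x₅ → 0 * x₁ + 1 * x₂ + 0 * x₃ + 0 * x₄ + 0 * x₅ ≡ x₂
  pick₂ = solve-∀
classify g h (s₃₁-plus (suc k)) =
  inj₂ (inj₁ (suc k , s≤s z≤n , λ x → trans (h x) (pick₂₃ (suc k) (s₄ x) (s₃₁ x) (s₂₂ x) (s₂₁₁ x) (s₁₁₁₁ x))))
  where
  pick₂₃ : ∀ k x₁ x₂ x₃ x₄ x₅ → 0 * x₁ + 1 * x₂ + k * x₃ + 0 * x₄ + 0 * x₅ ≡ x₂ + k * x₃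
  pick₂₃ = solve-∀
classify g h (multiple₂₂ k 1≤k) =
  inj₂ (inj₂ (inj₁ (k , 1≤k , λ x → trans (h x) (pick₃ k (s₄ x) (s₃₁ x) (s₂₂ x) (s₂₁₁ x) (s₁₁₁₁ x)))))
  where
  pick₃ : ∀ k x₁ x₂ x₃ x₄ x₅ → 0 * x₁ + 0 * x₂ + k * x₃ + 0 * x₄ + 0 * x₅ ≡ k * x₃
  pick₃ = solve-∀
classify g h (s₂₁₁-plus zero) =
  inj₁ (2 ∷ 1 ∷ 1 ∷ [] , (refl , s≤s z≤n ∷ s≤s z≤n ∷ s≤s z≤n ∷ [] , s≤s z≤n ∷ s≤s z≤n ∷ [-]) ,
        λ x → trans (h x) (pick₄ (s₄ x) (s₃₁ x) (s₂₂ x) (s₂₁₁ x) (s₁₁₁₁ x)))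
  where
  pick₄ : ∀ x₁ x₂ x₃ x₄ x₅ → 0 * x₁ + 0 * x₂ + 0 * x₃ + 1 * x₄ + 0 * x₅ ≡ x₄
  pick₄ = solve-∀
classify g h (s₂₁₁-plus (suc k)) =
  inj₂ (inj₂ (inj₂ (suc k , s≤s z≤n , λ x → trans (h x) (pick₄₃ (suc k) (s₄ x) (s₃₁ x) (s₂₂ x) (s₂₁₁ x) (s₁₁₁₁ x)))))
  where
  pick₄₃ : ∀ k x₁ x₂ x₃ x₄ x₅ → 0 * x₁ + 0 * x₂ + k * x₃ + 1 * x₄ + 0 * x₅ ≡ x₄ + k * x₃
  pick₄₃ = solve-∀

twice-≤2 : ∀ x {y} → x + (x + y) ≤ 2 → x ≤ 1
twice-≤2 zero          _                 = z≤n
twice-≤2 (suc zero)    _                 = s≤s z≤n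
twice-≤2 (suc (suc x)) (s≤s (s≤s x+2≤0)) with m+n≤o⇒n≤o x x+2≤0
... | ()

2+n≰1 : ∀ {n} → ¬ (2 + n ≤ 1)
2+n≰1 (s≤s ())

-- If the vertex counts are κ(D), then the endpoint
-- bound (b + b + d + d + a + e ≤ 2), isolation (a or e nonzero means a single vertex)
-- and nonemptiness leave only the listed shapes.
shape : ∀ a b c d e →
        sum (map (κ a b c d e) endTypes) ≤ 2 →
        (1 ≤ a ⊎ 1 ≤ e → sum (map (κ a b c d e) allTypes) ≤ 1) →
        1 ≤ sum (map (κ a b c d e) allTypes) →
        Shape a b c d e
-- b ≤ 1, and b = 1 forces a = d = e = 0
shape a       (suc (suc b)) c d e ends _ _ with twice-≤2 (suc (suc b)) ends
... | s≤s ()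
shape zero    1 c zero    zero    _              _ _ = s₃₁-plus c
shape a       1 c (suc d) e       (s≤s (s≤s ())) _ _
shape (suc a) 1 c zero    e       (s≤s (s≤s ())) _ _
shape zero    1 c zero    (suc e) (s≤s (s≤s ())) _ _
-- likewise with b = 0: d ≤ 1, and d = 1 forces a = e = 0
shape a       0 c (suc (suc d)) e ends _ _ with twice-≤2 (suc (suc d)) ends
... | s≤s ()
shape zero    0 c 1 zero    _              _ _ = s₂₁₁-plus c
shape (suc a) 0 c 1 e       (s≤s (s≤s ())) _ _
shape zero    0 c 1 (suc e) (s≤s (s≤s ())) _ _
-- b = d = 0: the total a + e + 2c is positive, and is 1 when a or e is nonzero
shape 0             0 0       0 0             _ _   ()
shape 0             0 (suc c) 0 0             _ _   _ = multiple₂₂ (suc c) (s≤s z≤n)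
shape 1             0 0       0 0             _ _   _ = only₄
shape 0             0 0       0 1             _ _   _ = only₁₁₁₁
shape (suc (suc a)) 0 c       0 e             _ one _ = ⊥-elim (2+n≰1 (one (inj₁ (s≤s z≤n))))
shape 1             0 c       0 (suc e)       _ one _ = ⊥-elim (2+n≰1 (one (inj₁ (s≤s z≤n))))
shape 1             0 (suc c) 0 0             _ one _ = ⊥-elim (2+n≰1 (one (inj₁ (s≤s z≤n))))
shape 0             0 c       0 (suc (suc e)) _ one _ = ⊥-elim (2+n≰1 (one (inj₂ (s≤s z≤n))))
shape 0             0 (suc c) 0 1             _ one _ = ⊥-elim (2+n≰1 (one (inj₂ (s≤s z≤n))))

-- Finite sums over Fin n

sum-map-tabulate : ∀ {A : Set} n (g : Fin n → A) (f : A → ℕ) → sum (map f (tabulate g)) ≡ ∑ (f ∘ g)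
sum-map-tabulate zero    g f = refl
sum-map-tabulate (suc n) g f = cong (f (g zero) +_) (sum-map-tabulate n (g ∘ suc) f)

∑-allFin : ∀ n (f : Fin n → ℕ) → sum (map f (allFin n)) ≡ ∑ f
∑-allFin n f = sum-map-tabulate n (λ v → v) f

∑-ones : ∀ n → ∑ {n} (λ _ → 1) ≡ n
∑-ones zero    = refl
∑-ones (suc n) = cong suc (∑-ones n)

∑-mono : ∀ {n} {f g : Fin n → ℕ} → (∀ v → f v ≤ g v) → ∑ f ≤ ∑ g
∑-mono {zero}  f≤g = z≤n
∑-mono {suc n} f≤g = +-mono-≤ (f≤g zero) (∑-mono (f≤g ∘ suc))

∑-positive : ∀ {n} (f : Fin n → ℕ) → 1 ≤ ∑ f → ∃ λ v → 1 ≤ f v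
∑-positive {suc n} f pos with f zero in eq
... | suc _ = zero , subst (1 ≤_) (sym eq) (s≤s z≤n)
... | zero  = let v , p = ∑-positive (f ∘ suc) pos in suc v , p

∑-interchange : ∀ {A : Set} {n} (us : List A) (F : A → Fin n → ℕ) →
                ∑ (λ v → sum (map (λ u → F u v) us)) ≡ sum (map (λ u → ∑ (F u)) us)
∑-interchange {n = n} []       F = sum-replicate-zero n
∑-interchange         (u ∷ us) F =
  trans (∑-distrib-+ (F u) _) (cong (∑ (F u) +_) (∑-interchange us F))

agree-at-head : ∀ {A : Set} (f g : A → ℕ) x ys → All (λ y → f y ≡ g y) ys →
                sum (map f (x ∷ ys)) ≡ sum (map g (x ∷ ys)) → f x ≡ g x
agree-at-head f g x ys same total =
  +-cancelʳ-≡ (sum (map g ys)) (f x) (g x) (trans (cong (f x +_) (sym rest)) total)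
  where
  rest : sum (map f ys) ≡ sum (map g ys)
  rest = cong sum (map-cong-local same)

δ : ∀ {n} → Fin n → Fin n → ℕ
δ u v = if does (u Fin.≟ v) then 1 else 0

∑-δ : ∀ {n} (u : Fin n) → ∑ (δ u) ≡ 1
∑-δ {suc n} zero    = cong suc (sum-replicate-zero n)
∑-δ {suc n} (suc u) = ∑-δ u

δ-self : ∀ {n} (u : Fin n) → δ u u ≡ 1
δ-self zero    = refl
δ-self (suc u) = δ-self u

∑-supported-on-two : ∀ {n} (f : Fin n → ℕ) (u w : Fin n) → (∀ v → f v ≤ 1) →
                     (∀ v → 1 ≤ f v → v ≡ u ⊎ v ≡ w) → ∑ f ≤ 2
∑-supported-on-two f u w f≤1 support = begin
  ∑ f                     ≤⟨ ∑-mono bound ⟩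
  ∑ (λ v → δ u v + δ w v) ≡⟨ ∑-distrib-+ (δ u) (δ w) ⟩
  ∑ (δ u) + ∑ (δ w)       ≡⟨ cong₂ _+_ (∑-δ u) (∑-δ w) ⟩
  2                       ∎
  where
  open ≤-Reasoning
  bound : ∀ v → f v ≤ δ u v + δ w v
  bound v with f v in eq
  ... | zero  = z≤n
  ... | suc _ = subst (_≤ δ u v + δ w v) eq
                  (≤-trans (f≤1 v) (point-mass (support v (subst (1 ≤_) (sym eq) (s≤s z≤n)))))
    where
    point-mass : v ≡ u ⊎ v ≡ w → 1 ≤ δ u v + δ w v
    point-mass (inj₁ refl) = ≤-trans (≤-reflexive (sym (δ-self v))) (m≤m+n _ _)
    point-mass (inj₂ refl) = ≤-trans (≤-reflexive (sym (δ-self v))) (m≤n+m _ _)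

all-equal-≤1 : ∀ {n} (u : Fin n) → (∀ v → v ≡ u) → n ≤ 1
all-equal-≤1 {1}           _ _   = ≤-refl
all-equal-≤1 {suc (suc n)} u all with trans (all zero) (sym (all (suc zero)))
... | ()

-- Two involutions generating a connected graph: a path or a cycle

least-witness : ∀ {P : ℕ → Set} → Decidable P → ∃ P → ∃ λ K → P K × (∀ j → j < K → ¬ P j)
least-witness {P} P? (k , pk) with search (suc k)
  where
  search : ∀ m → (∃ λ K → P K × (∀ j → j < K → ¬ P j)) ⊎ (∀ j → j < m → ¬ P j)
  search zero = inj₂ λ _ ()
  search (suc m) with search m
  ... | inj₁ found = inj₁ found
  ... | inj₂ none with P? m
  ...   | yes pm  = inj₁ (m , pm , none)
  ...   | no  ¬pm = inj₂ λ j j<1+m → [ none j , (λ { refl → ¬pm }) ]′ (m<1+n⇒m<n∨m≡n j<1+m)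
... | inj₁ found = found
... | inj₂ none  = ⊥-elim (none k ≤-refl pk)

Involutive : ∀ {n} → (Fin n → Fin n) → Set
Involutive h = ∀ v → h (h v) ≡ v

-- Fin n is connected by the maps f and g: every property closed under both holds
-- everywhere once it holds somewhere.
Connects : ∀ {n} → (Fin n → Fin n) → (Fin n → Fin n) → Set₁
Connects {n} f g = ∀ (P : Fin n → Set) → (∀ {v} → P v → P (f v)) → (∀ {v} → P v → P (g v)) →
                   ∀ {x y} → P x → P y

fixed-by-both : ∀ {n} {f g : Fin n → Fin n} → Connects f g →
                ∀ {u} → f u ≡ u → g u ≡ u → ∀ v → v ≡ u
fixed-by-both connects {u} fu gu v =
  connects (_≡ u) (λ { refl → fu }) (λ { refl → gu }) refl

-- Walking from a g-fixed vertex u by f, g, f, g, ...: the walk sweeps the whole graph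
-- and, up to its first bounce, meets every vertex fixed by f or g at its two ends.
module AlternatingWalk {n} (f g : Fin n → Fin n) (f-inv : Involutive f) (g-inv : Involutive g)
                       (connects : Connects f g) (u : Fin n) (gu≡u : g u ≡ u) where

  Endpoint : Fin n → Set
  Endpoint v = f v ≡ v ⊎ g v ≡ v

  step : ℕ → Fin n → Fin n
  step zero          = f
  step (suc zero)    = g
  step (suc (suc k)) = step k

  walk : ℕ → Fin n
  walk zero    = u
  walk (suc k) = step k (walk k)

  step-involutive : ∀ k → Involutive (step k)
  step-involutive zero          = f-inv
  step-involutive (suc zero)    = g-inv
  step-involutive (suc (suc k)) = step-involutive k

  steps-alternate : ∀ k → (step k ≗ f × step (suc k) ≗ g) ⊎ (step k ≗ g × step (suc k) ≗ f)
  steps-alternate zero          = inj₁ ((λ _ → refl) , (λ _ → refl))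
  steps-alternate (suc zero)    = inj₂ ((λ _ → refl) , (λ _ → refl))
  steps-alternate (suc (suc k)) = steps-alternate k

  neighbours : ∀ j →
    (f (walk (suc j)) ≡ walk j × g (walk (suc j)) ≡ walk (suc (suc j))) ⊎
    (g (walk (suc j)) ≡ walk j × f (walk (suc j)) ≡ walk (suc (suc j)))
  neighbours j with steps-alternate j
  ... | inj₁ (f-now , g-next) = inj₁ (trans (sym (f-now _)) back , sym (g-next _))
    where back = step-involutive j (walk j)
  ... | inj₂ (g-now , f-next) = inj₂ (trans (sym (g-now _)) back , sym (f-next _))
    where back = step-involutive j (walk j)

  OnWalk : Fin n → Set
  OnWalk v = ∃ λ k → walk k ≡ v

  on-walk : ∀ v → OnWalk v
  on-walk v = connects OnWalk (λ { (k , refl) → proj₁ (adjacent k) })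
                              (λ { (k , refl) → proj₂ (adjacent k) }) (0 , refl)
    where
    adjacent : ∀ k → OnWalk (f (walk k)) × OnWalk (g (walk k))
    adjacent zero    = (1 , refl) , (0 , sym gu≡u)
    adjacent (suc j) with neighbours j
    ... | inj₁ (f-back , g-on) = (j , sym f-back) , (suc (suc j) , sym g-on)
    ... | inj₂ (g-back , f-on) = (suc (suc j) , sym f-on) , (j , sym g-back)

  Bounce : ℕ → Set
  Bounce k = walk (suc k) ≡ walk k

  endpoint-bounce : ∀ j → Endpoint (walk (suc j)) → Bounce (suc j) ⊎ Bounce j
  endpoint-bounce j end with neighbours j | end
  ... | inj₁ (f-back , _)    | inj₁ f-fix = inj₂ (trans (sym f-fix) f-back)
  ... | inj₁ (_    , g-on)   | inj₂ g-fix = inj₁ (trans (sym g-on) g-fix)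
  ... | inj₂ (_    , f-on)   | inj₁ f-fix = inj₁ (trans (sym f-on) f-fix)
  ... | inj₂ (g-back , _)    | inj₂ g-fix = inj₂ (trans (sym g-fix) g-back)

  module UpToFirstBounce (K : ℕ) (bounce : Bounce K) (first : ∀ j → j < K → ¬ Bounce j) where

    Early : Fin n → Set
    Early v = ∃ λ m → m ≤ K × walk m ≡ v

    next : ∀ m → m ≤ K → Early (walk (suc m))
    next m m≤K with m≤n⇒m<n∨m≡n m≤K
    ... | inj₁ m<K  = suc m , m<K , refl
    ... | inj₂ refl = m , ≤-refl , sym bounce

    -- the walk up to the first bounce is closed under f and g, hence is everything
    early : ∀ v → Early v
    early v = connects Early (λ { (m , m≤K , refl) → proj₁ (adjacent m m≤K) })
                             (λ { (m , m≤K , refl) → proj₂ (adjacent m m≤K) }) (0 , z≤n , refl)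
      where
      adjacent : ∀ m → m ≤ K → Early (f (walk m)) × Early (g (walk m))
      adjacent zero    m≤K = next 0 m≤K , (0 , z≤n , sym gu≡u)
      adjacent (suc j) m≤K with neighbours j
      ... | inj₁ (f-back , g-on) =
        (j , ≤-trans (n≤1+n j) m≤K , sym f-back) , subst Early (sym g-on) (next (suc j) m≤K)
      ... | inj₂ (g-back , f-on) =
        subst Early (sym f-on) (next (suc j) m≤K) , (j , ≤-trans (n≤1+n j) m≤K , sym g-back)

    -- an endpoint strictly inside the walk would be an earlier bounce
    ends : ∀ v → Endpoint v → v ≡ u ⊎ v ≡ walk K
    ends v end with early v
    ... | zero  , _ , u≡v = inj₁ (sym u≡v)
    ... | suc j , 1+j≤K , refl with m≤n⇒m<n∨m≡n 1+j≤K
    ...   | inj₂ refl = inj₂ refl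
    ...   | inj₁ 1+j<K with endpoint-bounce j end
    ...     | inj₁ b = ⊥-elim (first (suc j) 1+j<K b)
    ...     | inj₂ b = ⊥-elim (first j (≤-trans (n≤1+n _) 1+j<K) b)

  endpoint? : ∀ v → Dec (Endpoint v)
  endpoint? v = (f v Fin.≟ v) ⊎-dec (g v Fin.≟ v)

  endpoints : ∃ λ w → ∀ v → Endpoint v → v ≡ u ⊎ v ≡ w
  endpoints with Fin.any? (λ v → endpoint? v ×-dec ¬? (v Fin.≟ u))
  ... | no none = u , λ v end → inj₁ (decidable-stable (v Fin.≟ u) (λ v≢u → none (v , end , v≢u)))
  ... | yes (v , end , v≢u) with on-walk v
  ...   | zero  , refl = ⊥-elim (v≢u refl)
  ...   | suc j , refl with least-witness (λ k → walk (suc k) Fin.≟ walk k)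
                                         ([ (λ b → suc j , b) , (λ b → j , b) ]′ (endpoint-bounce j end))
  ...     | K , bounce , first = walk K , UpToFirstBounce.ends K bounce first

at-most-two-endpoints : ∀ {n} {f g : Fin n → Fin n} → Involutive f → Involutive g → Connects f g →
                        ∀ u → f u ≡ u ⊎ g u ≡ u →
                        ∃ λ w → ∀ v → f v ≡ v ⊎ g v ≡ v → v ≡ u ⊎ v ≡ w
at-most-two-endpoints f-inv g-inv connects u (inj₂ gu≡u) =
  AlternatingWalk.endpoints _ _ f-inv g-inv connects u gu≡u
at-most-two-endpoints f-inv g-inv connects u (inj₁ fu≡u) =
  let w , ends = AlternatingWalk.endpoints _ _ g-inv f-inv (λ P pf pg → connects P pg pf) u fu≡u
  in w , λ v end → ends v (swap end)

-- Connected degree-4 graphs satisfying axiom 1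

-- LSP₄ at i = 3 restricts σ(v) to its entries 1..3, which is all of it.
take-all : (t : Type) → take 3 (toList t) ≡ toList t
take-all (_ ∷ _ ∷ _ ∷ []) = refl

module Degree4 (G : SCGraph 4 4) (ax1 : Ax1 G) (connected : Connected G) where
  open SCGraph G

  colour : ∀ {i v w} → Edge G i v w → i ≡ 2 ⊎ i ≡ 3
  colour {i} {v} {w} e = range i (E-range i v w e)
    where
    range : ∀ i → (1 < i) × (i < 4) → i ≡ 2 ⊎ i ≡ 3
    range 0 (() , _)
    range 1 (s≤s () , _)
    range 2 _ = inj₁ refl
    range 3 _ = inj₂ refl
    range (suc (suc (suc (suc _)))) (_ , s≤s (s≤s (s≤s (s≤s ()))))

  unique : ∀ {i v x y} → Edge G i v x → Edge G i v y → x ≡ y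
  unique {i} {v} {x} {y} ex ey = let 1<i , i<4 = E-range i v x ex in proj₂ (ax1 v i 1<i i<4) x y ex ey

  edge? : ∀ i v → Decidable (Edge G i v)
  edge? i v w = E i v w Bool.≟ true

  neighbour : ℕ → Fin size → Fin size
  neighbour i v with Fin.any? (edge? i v)
  ... | yes (w , _) = w
  ... | no  _       = v

  neighbour-edge : ∀ {i v w} → Edge G i v w → neighbour i v ≡ w
  neighbour-edge {i} {v} e with Fin.any? (edge? i v)
  ... | yes (_ , e′) = unique e′ e
  ... | no  none     = ⊥-elim (none (_ , e))

  neighbour-none : ∀ {i v} → ¬ ∃ (Edge G i v) → neighbour i v ≡ v
  neighbour-none {i} {v} none with Fin.any? (edge? i v)
  ... | yes found = ⊥-elim (none found)
  ... | no  _     = refl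

  neighbour-involutive : ∀ i → Involutive (neighbour i)
  neighbour-involutive i v with Fin.any? (edge? i v)
  ... | yes (w , e) = neighbour-edge (trans (E-sym i w v) e)
  ... | no  none    = neighbour-none none

  flat-fixed : ∀ {i} v → 1 < i → i < 4 → Flat i (σ v) → neighbour i v ≡ v
  flat-fixed {i} v 1<i i<4 flat =
    neighbour-none (λ edge → flat (Equivalence.from (proj₁ (ax1 v i 1<i i<4)) edge))

  flat-fixed₂ : ∀ v → Flat 2 (σ v) → neighbour 2 v ≡ v
  flat-fixed₂ v = flat-fixed v (s≤s (s≤s z≤n)) (s≤s (s≤s (s≤s z≤n)))

  flat-fixed₃ : ∀ v → Flat 3 (σ v) → neighbour 3 v ≡ v
  flat-fixed₃ v = flat-fixed v (s≤s (s≤s z≤n)) (s≤s (s≤s (s≤s (s≤s z≤n))))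

  -- every edge has colour 2 or 3, so connectivity is connectivity under the two neighbour maps
  connects : Connects (neighbour 2) (neighbour 3)
  connects P closed₂ closed₃ {x} {y} px = along (proj₂ connected x y) px
    where
    along : ∀ {a b} → Star (λ x y → ∃ λ i → Edge G i x y) a b → P a → P b
    along ε                pa = pa
    along ((i , e) ◅ path) pa with colour e
    ... | inj₁ refl = along path (subst P (neighbour-edge e) (closed₂ pa))
    ... | inj₂ refl = along path (subst P (neighbour-edge e) (closed₃ pa))

  -- LSP₄ at i = 3, where the component is the whole graph and the restricted
  -- generating function is the generating function itself.
  genFun-expansion : LSP G 4 → Expansion (genFun G)
  genFun-expansion lsp4 = expansion a b c d e (λ x → trans (unrestricted x) (expand x))
    where
    toEdgeIn : ∀ {x y} → (∃ λ i → Edge G i x y) → EdgeIn G 2 3 x y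
    toEdgeIn (i , e) with colour e
    ... | inj₁ refl = 2 , ≤-refl , s≤s (s≤s z≤n) , e
    ... | inj₂ refl = 3 , s≤s (s≤s z≤n) , ≤-refl , e
    whole : IsComponent G 2 3 (λ _ → true)
    whole = (proj₁ (proj₁ connected) , refl) ,
            (λ v w _ _ → Star.map toEdgeIn (proj₂ connected v w)) , (λ _ _ _ _ → refl)
    open Expansion (schurExpansion (lsp4 3 (s≤s (s≤s (s≤s z≤n))) (s≤s (s≤s (s≤s (s≤s z≤n)))) _ whole))
    unrestricted : genFun G ≐ restrictedGF G 4 3 (λ _ → true)
    unrestricted x = cong sum (map-cong (λ v → cong (λ σ′ → Q σ′ x) (sym (take-all (σ v)))) (allFin size))

  #_ : Type → ℕ
  # t = ∑ (λ v → ind t (σ v))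

  ∑-countIn : ∀ us → ∑ (λ v → countIn us (σ v)) ≡ sum (map #_ us)
  ∑-countIn us = ∑-interchange us (λ u v → ind u (σ v))

  genFun-at : ∀ S → genFun G (α S) ≡ sum (map #_ (below S))
  genFun-at S = begin
    genFun G (α S)                    ≡⟨ ∑-allFin size _ ⟩
    ∑ (λ v → Q (toList (σ v)) (α S))  ≡⟨ sum-cong-≗ (λ v → Q-at S (σ v)) ⟩
    ∑ (λ v → countIn (below S) (σ v)) ≡⟨ ∑-countIn (below S) ⟩
    sum (map #_ (below S))            ∎
    where open ≡-Reasoning

  -- each vertex has exactly one descent set
  vertex-total : size ≡ sum (map #_ allTypes)
  vertex-total = begin
    size                                ≡⟨ sym (∑-ones size) ⟩
    ∑ {size} (λ _ → 1)                  ≡⟨ sum-cong-≗ (λ v → sym (allTypes-once (σ v))) ⟩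
    ∑ (λ v → countIn allTypes (σ v))    ≡⟨ ∑-countIn allTypes ⟩
    sum (map #_ allTypes)               ∎
    where open ≡-Reasoning

  nonempty : 1 ≤ size
  nonempty = positive (proj₁ (proj₁ connected))
    where
    positive : ∀ {n} → Fin n → 1 ≤ n
    positive zero    = s≤s z≤n
    positive (suc _) = s≤s z≤n

  endpoint-count : sum (map #_ endTypes) ≤ 2
  endpoint-count = subst (_≤ 2) (∑-countIn endTypes) bound
    where
    Endpoint : Fin size → Set
    Endpoint v = neighbour 2 v ≡ v ⊎ neighbour 3 v ≡ v
    endpoint : ∀ v → 1 ≤ countIn endTypes (σ v) → Endpoint v
    endpoint v p with endType-flat (σ v) p
    ... | inj₁ flat₂ = inj₁ (flat-fixed₂ v flat₂)
    ... | inj₂ flat₃ = inj₂ (flat-fixed₃ v flat₃)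
    bound : ∑ (λ v → countIn endTypes (σ v)) ≤ 2
    bound with Fin.any? (λ v → 1 ≤? countIn endTypes (σ v))
    ... | yes (u , pu) =
      let w , ends = at-most-two-endpoints (neighbour-involutive 2) (neighbour-involutive 3)
                                           connects u (endpoint u pu)
      in ∑-supported-on-two _ u w (λ v → endType-≤1 (σ v)) (λ v pv → ends v (endpoint v pv))
    ... | no none =
      let u₀ = proj₁ (proj₁ connected)
      in ∑-supported-on-two _ u₀ u₀ (λ v → endType-≤1 (σ v)) (λ v pv → ⊥-elim (none (v , pv)))

  -- a vertex without sign changes has no edges, so it is the only vertex
  single-vertex : ∀ t → Flat 2 t → Flat 3 t → 1 ≤ # t → size ≤ 1
  single-vertex t flat₂ flat₃ present =
    let v , p = ∑-positive _ present
        t≡σv  = ind-positive t (σ v) p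
    in all-equal-≤1 v (fixed-by-both connects (flat-fixed₂ v (subst (Flat 2) t≡σv flat₂))
                                               (flat-fixed₃ v (subst (Flat 3) t≡σv flat₃)))

  module Counted (E : Expansion (genFun G)) where
    open Expansion E

    -- Möbius inversion over the subsets of {1,2,3}
    counts : ∀ t → # t ≡ κ a b c d e t
    counts = every-type _ c∅ c1 c2 c3 c12 c13 c23 c123
      where
      from : ∀ S → All (λ u → # u ≡ κ a b c d e u) (strictlyBelow S) → # S ≡ κ a b c d e S
      from S lower = agree-at-head #_ (κ a b c d e) S (strictlyBelow S) lower
        (trans (sym (genFun-at S)) (trans (expand (α S)) (combination-at a b c d e S)))
      c∅ : # D∅ ≡ a
      c∅ = from D∅ []
      c1 : # D1 ≡ b
      c1 = from D1 (c∅ ∷ [])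
      c2 : # D2 ≡ b + c
      c2 = from D2 (c∅ ∷ [])
      c3 : # D3 ≡ b
      c3 = from D3 (c∅ ∷ [])
      c12 : # D12 ≡ d
      c12 = from D12 (c∅ ∷ c1 ∷ c2 ∷ [])
      c13 : # D13 ≡ c + d
      c13 = from D13 (c∅ ∷ c1 ∷ c3 ∷ [])
      c23 : # D23 ≡ d
      c23 = from D23 (c∅ ∷ c2 ∷ c3 ∷ [])
      c123 : # D123 ≡ e
      c123 = from D123 (c∅ ∷ c1 ∷ c2 ∷ c3 ∷ c12 ∷ c13 ∷ c23 ∷ [])

    counted : ∀ ts → sum (map #_ ts) ≡ sum (map (κ a b c d e) ts)
    counted ts = cong sum (map-cong counts ts)

    vertices : size ≡ sum (map (κ a b c d e) allTypes)
    vertices = trans vertex-total (counted allTypes)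

    endpoint-bound : sum (map (κ a b c d e) endTypes) ≤ 2
    endpoint-bound = subst (_≤ 2) (counted endTypes) endpoint-count

    isolation : 1 ≤ a ⊎ 1 ≤ e → sum (map (κ a b c d e) allTypes) ≤ 1
    isolation (inj₁ 1≤a) =
      subst (_≤ 1) vertices (single-vertex D∅ (λ ()) (λ ()) (subst (1 ≤_) (sym (counts D∅)) 1≤a))
    isolation (inj₂ 1≤e) =
      subst (_≤ 1) vertices (single-vertex D123 (λ ()) (λ ()) (subst (1 ≤_) (sym (counts D123)) 1≤e))

    some-vertex : 1 ≤ sum (map (κ a b c d e) allTypes)
    some-vertex = subst (1 ≤_) vertices nonempty

proposition3p5 : (G : SCGraph 4 4) → Connected G → LocallySchurPositive G →
    (Σ (List ℕ) λ lam → IsPartition 4 lam × (genFun G ≐ s lam))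
    ⊎ (Σ ℕ λ k → (1 ≤ k) × (genFun G ≐ (s (3 ∷ 1 ∷ []) ⊕ (k · s (2 ∷ 2 ∷ [])))))
    ⊎ (Σ ℕ λ k → (1 ≤ k) × (genFun G ≐ (k · s (2 ∷ 2 ∷ []))))
    ⊎ (Σ ℕ λ k → (1 ≤ k) × (genFun G ≐ (s (2 ∷ 1 ∷ 1 ∷ []) ⊕ (k · s (2 ∷ 2 ∷ [])))))
proposition3p5 G connected (ax1 , _ , _ , _ , lsp4 , _) =
  classify (genFun G) expand (shape a b c d e endpoint-bound isolation some-vertex)
  where
  open Degree4 G ax1 connected
  E : Expansion (genFun G)
  E = genFun-expansion lsp4
  open Expansion E
  open Counted E
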